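{- Let $G$ be a graph with vertex set $\{1,\dots,n\}$ and let $F_1,\dots,F_k$ ($1\le k\le n$) be pairwise disjoint forts of $G$, with incidence vectors $\mathbf v_1,\dots,\mathbf v_k\in\mathbb R^n$. Then there is a matrix $A\in\mathbb R^{n\times n}$ with $\mathcal G(A)=G$ such that $A\mathbf v_i=\mathbf 0$ for $i=1,\dots,k$. Consequently, $\operatorname{N}(G)\ge\operatorname{ft}(G)$.
   Context: A fort of $G$ is a nonempty $F\subseteq V(G)$ such that every $v\in V(G)\setminus F$ has $|N_G(v)\cap F|\neq 1$; $\operatorname{ft}(G)$ is the maximum number of pairwise disjoint forts of $G$. The incidence vector $\mathbf v=[v_j]$ of a fort $F$ has $v_j=1$ if $j\in F$ and $v_j=0$ otherwise. A matrix $A=[a_{ij}]$ is combinatorially symmetric if $a_{ij}\neq 0\iff a_{ji}\neq 0$; for such $A$, $\mathcal G(A)$ is the graph on $\{1,\dots,n\}$ with edges $\{i,j\}$ ($i<j$) such that $a_{ij}\ne 0$ (writing $\mathcal G(A)$ presupposes $A$ is combinatorially symmetric; diagonal entries are unrestricted). $\operatorname{N}(G)=\max\{\operatorname{null}A : A\in\mathbb R^{n\times n},\ \mathcal G(A)=G\}$. -}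

module Defs where

open import Data.Nat using (ℕ; zero; suc)
open import Data.Bool using (Bool; true; false; if_then_else_)
open import Data.Fin using (Fin; zero; suc)
open import Data.Fin.Subset using (Subset; _∈_; _∉_; _∩_; ∣_∣; Nonempty; Empty)
open import Data.Vec using (tabulate; lookup)
open import Data.Rational using (ℚ; 0ℚ; 1ℚ; _+_; _*_)
open import Data.Product using (Σ; ∃; _×_)
open import Relation.Binary.PropositionalEquality using (_≡_; _≢_)
open import Relation.Nullary using (¬_)
open import Function.Bundles using (_⇔_)

record Graph (n : ℕ) : Set where
  field
    Adj     : Fin n → Fin n → Bool
    symm    : ∀ i j → Adj i j ≡ Adj j i
    irrefl  : ∀ i → Adj i i ≡ false
open Graph public

N[_] : ∀ {n} → Graph n → Fin n → Subset n
N[ G ] v = tabulate (Adj G v)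

IsFort : ∀ {n} → Graph n → Subset n → Set
IsFort G F = Nonempty F × (∀ v → v ∉ F → ∣ N[ G ] v ∩ F ∣ ≢ 1)

Disjoint : ∀ {n} → Subset n → Subset n → Set
Disjoint p q = Empty (p ∩ q)

PairwiseDisjointForts : ∀ {n k} → Graph n → (Fin k → Subset n) → Set
PairwiseDisjointForts G F = (∀ i → IsFort G (F i)) × (∀ i j → i ≢ j → Disjoint (F i) (F j))

incidence : ∀ {n} → Subset n → Fin n → ℚ
incidence F j = if lookup F j then 1ℚ else 0ℚ

Matrix : ℕ → Set
Matrix n = Fin n → Fin n → ℚ

Σℚ : ∀ {n} → (Fin n → ℚ) → ℚ
Σℚ {zero}  f = 0ℚ
Σℚ {suc n} f = f zero + Σℚ (λ i → f (suc i))

_·_ : ∀ {n} → Matrix n → (Fin n → ℚ) → Fin n → ℚ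
(A · v) i = Σℚ (λ j → A i j * v j)

IsZeroVec : ∀ {n} → (Fin n → ℚ) → Set
IsZeroVec v = ∀ i → v i ≡ 0ℚ

-- 𝒢(A) = G : off-diagonal nonzero pattern equals adjacency (diagonal unrestricted).
-- Combinatorial symmetry of A follows since Adj is symmetric.
PatternOf : ∀ {n} → Matrix n → Graph n → Set
PatternOf A G = ∀ i j → i ≢ j → (A i j ≢ 0ℚ) ⇔ (Adj G i j ≡ true)

LinIndep : ∀ {n m} → (Fin m → Fin n → ℚ) → Set
LinIndep {n} {m} w = ∀ (c : Fin m → ℚ) → IsZeroVec (λ j → Σℚ (λ i → c i * w i j)) → ∀ i → c i ≡ 0ℚ

NullityAtLeast : ∀ {n} → Matrix n → ℕ → Set
NullityAtLeast {n} A m = Σ (Fin m → Fin n → ℚ) λ w → LinIndep w × (∀ i → IsZeroVec (A · w i))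

HasDisjointForts : ∀ {n} → Graph n → ℕ → Set
HasDisjointForts {n} G m = Σ (Fin m → Subset n) λ F → PairwiseDisjointForts G F

-- N(G) ≥ ft(G), unfolded via the two maxima:
-- every m attained by ft (m disjoint forts) is attained by some nullity.
N≥ft : ∀ {n} → Graph n → Set
N≥ft G = ∀ m → HasDisjointForts G m → Σ _ λ A → PatternOf A G × NullityAtLeast A m

{-# OPTIONS --safe #-}
-- Row u of A must be nonzero off the diagonal exactly on N(u) and must sum to zero over each
-- fort. The forts are disjoint, so each one constrains its own block N(u) ∩ F of the row. If
-- u ∉ F, the fort condition says the block does not have exactly one element, and a set of size
-- ≠ 1 carries nonzero weights summing to zero. At most one fort contains u, and for it the
-- unrestricted diagonal entry absorbs whatever the block sums to. Finally, incidence vectors of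
-- disjoint nonempty sets are linearly independent, which gives N(G) ≥ ft(G).
module Submission where

open import Defs
open import Algebra.Properties.Group using (x∙y⁻¹≈ε⇒x≈y)
open import Data.Bool using (Bool; true; false; _∧_; if_then_else_)
open import Data.Empty using (⊥-elim)
open import Data.Fin using (Fin; zero; suc; punchIn)
open import Data.Fin.Properties using (any?; punchInᵢ≢i) renaming (_≟_ to _≟ᶠ_)
open import Data.Fin.Subset using (Subset; inside; outside; _∈_; _∉_; _∩_; ∣_∣; Nonempty)
open import Data.Fin.Subset.Properties using (_∈?_; x∈p∩q⁺; x∈p∩q⁻)
open import Data.Nat using (ℕ; zero; suc; _≤_)
open import Data.Product using (Σ; ∃; _×_; _,_; proj₁; proj₂)
open import Data.Rational using (ℚ; 0ℚ; 1ℚ; _+_; _*_; -_; _-_)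
open import Data.Rational.Properties
  using (_≟_; 1≢0; +-inverseʳ; +-identityˡ; +-identityʳ; *-identityʳ; *-zeroˡ; *-zeroʳ; +-0-group; +-0-commutativeMonoid)
open import Data.Rational.Solver using (module +-*-Solver)
open import Data.Vec using ([]; _∷_; lookup; tabulate)
open import Data.Vec.Functional using (updateAt; removeAt; replicate) renaming (_∷_ to _◂_)
open import Data.Vec.Functional.Properties using (updateAt-updates; updateAt-minimal)
open import Data.Vec.Properties using ([]=⇒lookup; lookup⇒[]=; lookup∘tabulate; lookup-zipWith)
open import Function using (_∘_; _⇔_; mk⇔)
open import Relation.Binary.PropositionalEquality
open import Relation.Nullary using (yes; no)

open import Algebra.Properties.CommutativeMonoid.Sum +-0-commutativeMonoid
  using (sum; sum-cong-≗; sum-remove; sum-replicate-zero)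

Σℚ≡sum : ∀ {n} (f : Fin n → ℚ) → Σℚ f ≡ sum f
Σℚ≡sum {zero}  f = refl
Σℚ≡sum {suc n} f = cong (f zero +_) (Σℚ≡sum (f ∘ suc))

sum-δ : ∀ {n} (f : Fin n → ℚ) i → (∀ j → j ≢ i → f j ≡ 0ℚ) → sum f ≡ f i
sum-δ {suc n} f i vanishes = begin
  sum f                     ≡⟨ sum-remove {i = i} f ⟩
  f i + sum (removeAt f i)  ≡⟨ cong (f i +_) (sum-cong-≗ (λ j → vanishes (punchIn i j) (punchInᵢ≢i i j))) ⟩
  f i + sum (replicate n 0ℚ) ≡⟨ cong (f i +_) (sum-replicate-zero n) ⟩
  f i + 0ℚ                  ≡⟨ +-identityʳ (f i) ⟩
  f i                       ∎
  where open ≡-Reasoning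

sum-updateAt : ∀ {n} (f g : Fin n → ℚ) u c →
               sum (λ j → updateAt f u (_+ c) j * g j) ≡ sum (λ j → f j * g j) + c * g u
sum-updateAt {suc n} f g u c = begin
  sum (λ j → updateAt f u (_+ c) j * g j)
    ≡⟨ sum-remove {i = u} (λ j → updateAt f u (_+ c) j * g j) ⟩
  updateAt f u (_+ c) u * g u + sum (removeAt (λ j → updateAt f u (_+ c) j * g j) u)
    ≡⟨ cong₂ _+_ (cong (_* g u) (updateAt-updates u f))
                 (sum-cong-≗ (λ j → cong (_* g (punchIn u j)) (updateAt-minimal (punchIn u j) u f (punchInᵢ≢i u j)))) ⟩
  (f u + c) * g u + sum (removeAt (λ j → f j * g j) u)
    ≡⟨ rearrange (f u) c (g u) _ ⟩
  (f u * g u + sum (removeAt (λ j → f j * g j) u)) + c * g u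
    ≡⟨ cong (_+ c * g u) (sum-remove {i = u} (λ j → f j * g j)) ⟨
  sum (λ j → f j * g j) + c * g u ∎
  where
  open ≡-Reasoning
  rearrange : ∀ a c b s → (a + c) * b + s ≡ (a * b + s) + c * b
  rearrange = solve 4 (λ a c b s → (a :+ c) :* b :+ s := (a :* b :+ s) :+ c :* b) refl
    where open +-*-Solver

incidence-∈ : ∀ {n} {p : Subset n} {j} → j ∈ p → incidence p j ≡ 1ℚ
incidence-∈ j∈p rewrite []=⇒lookup j∈p = refl

incidence-∉ : ∀ {n} {p : Subset n} {j} → j ∉ p → incidence p j ≡ 0ℚ
incidence-∉ {p = p} {j} j∉p with lookup p j in eq
... | false = refl
... | true  = ⊥-elim (j∉p (lookup⇒[]= j p eq))

mask : ∀ {n} → (Fin n → Bool) → (Fin n → ℚ) → Fin n → ℚ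
mask s W j = if s j then W j else 0ℚ

mask-support : ∀ {n} (s : Fin n → Bool) {W : Fin n → ℚ} → (∀ j → W j ≢ 0ℚ) → ∀ j → mask s W j ≢ 0ℚ ⇔ s j ≡ true
mask-support s W≢0 j with s j
... | true  = mk⇔ (λ _ → refl) (λ _ → W≢0 j)
... | false = mk⇔ (λ 0≢0 → ⊥-elim (0≢0 refl)) (λ ())

mask-*-incidence : ∀ {n} (s : Fin n → Bool) (W : Fin n → ℚ) (p : Subset n) j →
                   mask s W j * incidence p j ≡ W j * incidence (tabulate s ∩ p) j
mask-*-incidence s W p j rewrite lookup-zipWith _∧_ j (tabulate s) p | lookup∘tabulate s j with s j
... | true  = refl
... | false = trans (*-zeroˡ (incidence p j)) (sym (*-zeroʳ (W j)))

*-incidence-cong : ∀ {n} {p : Subset n} {f g : Fin n → ℚ} → (∀ j → j ∈ p → f j ≡ g j) →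
                   ∀ j → f j * incidence p j ≡ g j * incidence p j
*-incidence-cong {p = p} {f} {g} f≡g j with j ∈? p
... | yes j∈p = cong (_* incidence p j) (f≡g j j∈p)
... | no  j∉p rewrite incidence-∉ j∉p = trans (*-zeroʳ (f j)) (sym (*-zeroʳ (g j)))

PairwiseDisjoint : ∀ {n k} → (Fin k → Subset n) → Set
PairwiseDisjoint F = ∀ i j → i ≢ j → Disjoint (F i) (F j)

disjoint-unique : ∀ {n k} {F : Fin k → Subset n} → PairwiseDisjoint F →
                  ∀ {x i j} → x ∈ F i → x ∈ F j → i ≡ j
disjoint-unique disjoint {i = i} {j = j} x∈Fi x∈Fj with i ≟ᶠ j
... | yes i≡j = i≡j
... | no  i≢j = ⊥-elim (disjoint i j i≢j (_ , x∈p∩q⁺ (x∈Fi , x∈Fj)))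

∃-nonzero-≢ : ∀ t → ∃ λ x → x ≢ 0ℚ × x ≢ t
∃-nonzero-≢ t with t ≟ 1ℚ
... | yes refl = - 1ℚ , (λ ()) , (λ ())
... | no  t≢1  = 1ℚ , 1≢0 , t≢1 ∘ sym

∃-first-weight : ∀ (c : ℕ) t → (c ≡ 0 → t ≢ 0ℚ) →
                 ∃ λ x → x ≢ 0ℚ × (c ≡ 0 → t - x ≡ 0ℚ) × (c ≡ 1 → t - x ≢ 0ℚ)
∃-first-weight zero    t t≢0 = t , t≢0 refl , (λ _ → +-inverseʳ t) , λ ()
∃-first-weight (suc c) t _   with ∃-nonzero-≢ t
... | x , x≢0 , x≢t = x , x≢0 , (λ ()) , λ _ t-x≡0 → x≢t (sym (x∙y⁻¹≈ε⇒x≈y +-0-group t x t-x≡0))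

◂-nonzero : ∀ {n x} {w : Fin n → ℚ} → x ≢ 0ℚ → (∀ j → w j ≢ 0ℚ) → ∀ j → (x ◂ w) j ≢ 0ℚ
◂-nonzero x≢0 w≢0 zero    = x≢0
◂-nonzero x≢0 w≢0 (suc j) = w≢0 j

-- Prescribing the sum t, not just 0, is what lets the induction peel off the first element of T.
nonzero-weights-with-sum : ∀ {n} (T : Subset n) t → (∣ T ∣ ≡ 0 → t ≡ 0ℚ) → (∣ T ∣ ≡ 1 → t ≢ 0ℚ) →
                           ∃ λ (w : Fin n → ℚ) → (∀ j → w j ≢ 0ℚ) × sum (λ j → w j * incidence T j) ≡ t
nonzero-weights-with-sum [] t empty⇒0 _ = (λ ()) , (λ ()) , sym (empty⇒0 refl)
nonzero-weights-with-sum (outside ∷ T) t empty⇒0 single⇒≢0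
  with nonzero-weights-with-sum T t empty⇒0 single⇒≢0
... | w , w≢0 , Σw≡t = (1ℚ ◂ w) , ◂-nonzero 1≢0 w≢0 , trans (+-identityˡ _) Σw≡t
nonzero-weights-with-sum (inside ∷ T) t _ single⇒≢0
  with ∃-first-weight ∣ T ∣ t (single⇒≢0 ∘ cong suc)
... | x , x≢0 , empty⇒0 , single⇒≢0′
  with nonzero-weights-with-sum T (t - x) empty⇒0 single⇒≢0′
... | w , w≢0 , Σw≡t-x = (x ◂ w) , ◂-nonzero x≢0 w≢0 , sum≡t
  where
  sum≡t : x * 1ℚ + sum (λ j → w j * incidence T j) ≡ t
  sum≡t = trans (cong (x * 1ℚ +_) Σw≡t-x) (solve 2 (λ x t → x :* con 1ℚ :+ (t :- x) := t) refl x t)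
    where open +-*-Solver

Annihilates : ∀ {n} → (Fin n → ℚ) → Subset n → Set
Annihilates ρ p = sum (λ j → ρ j * incidence p j) ≡ 0ℚ

module _ {n k} {F : Fin k → Subset n} (disjoint : PairwiseDisjoint F) where

  glue : (w : Fin k → Fin n → ℚ) → (∀ i j → w i j ≢ 0ℚ) →
         ∃ λ (W : Fin n → ℚ) → (∀ j → W j ≢ 0ℚ) × (∀ i j → j ∈ F i → W j ≡ w i j)
  glue w w≢0 = proj₁ ∘ pick , proj₁ ∘ proj₂ ∘ pick , λ i j → proj₂ (proj₂ (pick j)) i
    where
    pick : ∀ j → ∃ λ x → x ≢ 0ℚ × (∀ i → j ∈ F i → x ≡ w i j)
    pick j with any? (λ i → j ∈? F i)
    ... | yes (i , j∈Fi) = w i j , w≢0 i j , λ i′ j∈Fi′ → cong (λ i → w i j) (disjoint-unique disjoint j∈Fi j∈Fi′)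
    ... | no  j∉⋃F      = 1ℚ , 1≢0 , λ i j∈Fi → ⊥-elim (j∉⋃F (i , j∈Fi))

  -- The diagonal entry is seen only by the fort containing u, so shifting it repairs that fort's sum.
  correct-diagonal : (ρ : Fin n → ℚ) (u : Fin n) → (∀ i → u ∉ F i → Annihilates ρ (F i)) →
                     ∃ λ ρ′ → (∀ j → u ≢ j → ρ′ j ≡ ρ j) × (∀ i → Annihilates ρ′ (F i))
  correct-diagonal ρ u annihilates with any? (λ i → u ∈? F i)
  ... | no  u∉⋃F = ρ , (λ _ _ → refl) , λ i → annihilates i (λ u∈Fi → u∉⋃F (i , u∈Fi))
  ... | yes (i₀ , u∈Fi₀) = updateAt ρ u (_+ c) , (λ j u≢j → updateAt-minimal j u ρ (u≢j ∘ sym)) , annihilates′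
    where
    c : ℚ
    c = - sum (λ j → ρ j * incidence (F i₀) j)
    annihilates′ : ∀ i → Annihilates (updateAt ρ u (_+ c)) (F i)
    annihilates′ i with u ∈? F i
    ... | no u∉Fi = begin
      sum (λ j → updateAt ρ u (_+ c) j * incidence (F i) j)
        ≡⟨ sum-updateAt ρ (incidence (F i)) u c ⟩
      sum (λ j → ρ j * incidence (F i) j) + c * incidence (F i) u
        ≡⟨ cong₂ (λ s x → s + c * x) (annihilates i u∉Fi) (incidence-∉ u∉Fi) ⟩
      0ℚ + c * 0ℚ
        ≡⟨ solve 1 (λ c → con 0ℚ :+ c :* con 0ℚ := con 0ℚ) refl c ⟩
      0ℚ ∎
      where
      open ≡-Reasoning
      open +-*-Solver
    ... | yes u∈Fi with disjoint-unique disjoint u∈Fi u∈Fi₀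
    ...   | refl = begin
      sum (λ j → updateAt ρ u (_+ c) j * incidence (F i) j)
        ≡⟨ sum-updateAt ρ (incidence (F i)) u c ⟩
      s + c * incidence (F i) u
        ≡⟨ cong (λ x → s + c * x) (incidence-∈ u∈Fi) ⟩
      s + - s * 1ℚ
        ≡⟨ solve 1 (λ s → s :+ :- s :* con 1ℚ := con 0ℚ) refl s ⟩
      0ℚ ∎
      where
      s : ℚ
      s = sum (λ j → ρ j * incidence (F i) j)
      open ≡-Reasoning
      open +-*-Solver

  nonzero-block-weights : (s : Fin n → Bool) (u : Fin n) → (∀ i → u ∉ F i → ∣ tabulate s ∩ F i ∣ ≢ 1) →
                          ∃ λ W → (∀ j → W j ≢ 0ℚ) × (∀ i → u ∉ F i → Annihilates W (tabulate s ∩ F i))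
  nonzero-block-weights s u sparse =
    let W , W≢0 , W≡w = glue (proj₁ ∘ weights) (proj₁ ∘ proj₂ ∘ weights) in
    W , W≢0 , λ i u∉Fi →
      trans (sum-cong-≗ (*-incidence-cong (λ j j∈T → W≡w i j (proj₂ (x∈p∩q⁻ (tabulate s) (F i) j∈T)))))
            (proj₂ (proj₂ (weights i)) u∉Fi)
    where
    weights : ∀ i → ∃ λ w → (∀ j → w j ≢ 0ℚ) × (u ∉ F i → Annihilates w (tabulate s ∩ F i))
    weights i with u ∈? F i
    ... | yes u∈Fi = (λ _ → 1ℚ) , (λ _ → 1≢0) , λ u∉Fi → ⊥-elim (u∉Fi u∈Fi)
    ... | no  u∉Fi =
      let w , w≢0 , Σw≡0 = nonzero-weights-with-sum (tabulate s ∩ F i) 0ℚ (λ _ → refl) (λ single _ → sparse i u∉Fi single)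
      in w , w≢0 , λ _ → Σw≡0

  annihilating-row : (s : Fin n → Bool) (u : Fin n) → (∀ i → u ∉ F i → ∣ tabulate s ∩ F i ∣ ≢ 1) →
                     ∃ λ ρ → (∀ j → u ≢ j → (ρ j ≢ 0ℚ ⇔ s j ≡ true)) × (∀ i → Annihilates ρ (F i))
  annihilating-row s u sparse =
    let W , W≢0 , blocks = nonzero-block-weights s u sparse
        ρ , ρ≡mask , annihilates = correct-diagonal (mask s W) u λ i u∉Fi →
          trans (sum-cong-≗ (mask-*-incidence s W (F i))) (blocks i u∉Fi)
    in ρ , (λ j u≢j → subst (λ x → x ≢ 0ℚ ⇔ s j ≡ true) (sym (ρ≡mask j u≢j)) (mask-support s W≢0 j)) , annihilates

fort-annihilator : ∀ {n k} (G : Graph n) (F : Fin k → Subset n) → PairwiseDisjointForts G F →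
                   Σ (Matrix n) λ A → PatternOf A G × (∀ i → IsZeroVec (A · incidence (F i)))
fort-annihilator {n} G F (forts , disjoint) = A , (λ u → proj₁ (proj₂ (row u))) , annihilates
  where
  row : ∀ u → ∃ λ ρ → (∀ j → u ≢ j → (ρ j ≢ 0ℚ ⇔ Adj G u j ≡ true)) × (∀ i → Annihilates ρ (F i))
  row u = annihilating-row disjoint (Adj G u) u (λ i → proj₂ (forts i) u)
  A : Matrix n
  A u = proj₁ (row u)
  annihilates : ∀ i → IsZeroVec (A · incidence (F i))
  annihilates i u = trans (Σℚ≡sum (λ j → A u j * incidence (F i) j)) (proj₂ (proj₂ (row u)) i)

disjoint-incidences-independent : ∀ {n k} (F : Fin k → Subset n) → PairwiseDisjoint F → (∀ i → Nonempty (F i)) →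
                                  LinIndep (λ i → incidence (F i))
disjoint-incidences-independent F disjoint nonempty c combination≡0 i with nonempty i
... | x , x∈Fi = begin
  c i                                    ≡⟨ *-identityʳ (c i) ⟨
  c i * 1ℚ                               ≡⟨ cong (c i *_) (incidence-∈ x∈Fi) ⟨
  c i * incidence (F i) x                ≡⟨ sum-δ (λ i′ → c i′ * incidence (F i′) x) i vanishes ⟨
  sum (λ i′ → c i′ * incidence (F i′) x) ≡⟨ Σℚ≡sum (λ i′ → c i′ * incidence (F i′) x) ⟨
  Σℚ (λ i′ → c i′ * incidence (F i′) x) ≡⟨ combination≡0 x ⟩
  0ℚ                                     ∎
  where
  open ≡-Reasoning
  vanishes : ∀ i′ → i′ ≢ i → c i′ * incidence (F i′) x ≡ 0ℚ
  vanishes i′ i′≢i = trans (cong (c i′ *_) (incidence-∉ (i′≢i ∘ λ x∈Fi′ → disjoint-unique disjoint x∈Fi′ x∈Fi)))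
                           (*-zeroʳ (c i′))

proposition6p3 : (∀ {n k} (G : Graph n) (F : Fin k → Subset n) → 1 ≤ k → k ≤ n →
    PairwiseDisjointForts G F →
    Σ (Matrix n) λ A → PatternOf A G × (∀ i → IsZeroVec (A · incidence (F i))))
    × (∀ {n} (G : Graph n) → N≥ft G)
proposition6p3 = (λ G F _ _ → fort-annihilator G F) , N≥ft-holds
  where
  N≥ft-holds : ∀ {n} (G : Graph n) → N≥ft G
  N≥ft-holds G m (F , forts , disjoint) with fort-annihilator G F (forts , disjoint)
  ... | A , support , annihilates =
    A , support , (λ i → incidence (F i)) , disjoint-incidences-independent F disjoint (proj₁ ∘ forts) , annihilates
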